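{- Let $\mathcal{F}\subseteq 2^{[n]}$ be such that $G_\mathcal{F}$ is disconnected and, for every $X\in 2^{[n]}\setminus\mathcal{F}$, the graph $G_{\mathcal{F}\cup\{X\}}$ is connected, and suppose $G_\mathcal{F}$ consists of two components with vertex sets $\mathcal{A}$ and $\mathcal{B}$. If $F\in\mathcal{F}^+$, then $\mathcal{F}^-$ contains at least $|F|-1$ sets, each of size at least $|F|-2$. Similarly, if $F\in\mathcal{F}^-$, then $\mathcal{F}^+$ contains at least $n-|F|-1$ sets, each of size at most $|F|+2$.
   Context: For $\mathcal{F}\subseteq 2^{[n]}$, $G_\mathcal{F}$ is the graph on $\mathcal{F}$ with distinct $A,B$ adjacent iff $A\subseteq B$ or $B\subseteq A$. For a family $\mathcal{G}$, $\partial^+(\mathcal{G})=\{X\subseteq[n]: G\subseteq X\text{ for some }G\in\mathcal{G}\}$ and $\partial^-(\mathcal{G})=\{X\subseteq[n]: X\subseteq G\text{ for some }G\in\mathcal{G}\}$. $\mathcal{F}^+$ is the set of $F\subseteq[n]$ with $F\notin\partial^-(\mathcal{A})\cup\partial^-(\mathcal{B})$ such that every proper subset of $F$ lies in $\partial^-(\mathcal{A})\cup\partial^-(\mathcal{B})$; $\mathcal{F}^-$ is the set of $F\subseteq[n]$ with $F\notin\partial^+(\mathcal{A})\cup\partial^+(\mathcal{B})$ such that every proper superset of $F$ (within $[n]$) lies in $\partial^+(\mathcal{A})\cup\partial^+(\mathcal{B})$. -}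

module Defs where

open import Data.Nat using (ℕ)
open import Data.Bool using (Bool; true; false; _∨_)
open import Data.Fin.Subset using (Subset; _⊆_; _⊂_)
open import Data.Vec.Properties using (≡-dec)
import Data.Bool as B
open import Data.Product using (Σ; ∃; _×_; _,_)
open import Data.Sum using (_⊎_)
open import Relation.Binary.PropositionalEquality using (_≡_; _≢_)
open import Relation.Nullary using (¬_)
open import Relation.Nullary.Decidable using (⌊_⌋)

-- A family of subsets of [n] = {0,…,n-1}, given by its indicator function.
Family : ℕ → Set
Family n = Subset n → Bool

module _ {n : ℕ} where

  infix 4 _∈𝓕_
  _∈𝓕_ : Subset n → Family n → Set
  X ∈𝓕 𝓕 = 𝓕 X ≡ true

  insert : Subset n → Family n → Family n
  insert X 𝓕 Y = 𝓕 Y ∨ ⌊ ≡-dec B._≟_ Y X ⌋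

  -- adjacency in the comparability graph G_𝓕 (distinct and comparable)
  Adj : Subset n → Subset n → Set
  Adj A B = A ≢ B × (A ⊆ B ⊎ B ⊆ A)

  data Walk (𝓕 : Family n) : Subset n → Subset n → Set where
    here : ∀ {X} → X ∈𝓕 𝓕 → Walk 𝓕 X X
    step : ∀ {X Y Z} → X ∈𝓕 𝓕 → Adj X Y → Walk 𝓕 Y Z → Walk 𝓕 X Z

  Connected : Family n → Set
  Connected 𝓕 = ∀ X Y → X ∈𝓕 𝓕 → Y ∈𝓕 𝓕 → Walk 𝓕 X Y

  TwoComponents : Family n → Family n → Family n → Set
  TwoComponents 𝓕 𝓐 𝓑 =
    (∀ X → X ∈𝓕 𝓕 → X ∈𝓕 𝓐 ⊎ X ∈𝓕 𝓑) ×
    (∀ X → X ∈𝓕 𝓐 ⊎ X ∈𝓕 𝓑 → X ∈𝓕 𝓕) ×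
    (∀ X → X ∈𝓕 𝓐 → ¬ (X ∈𝓕 𝓑)) ×
    (∃ λ X → X ∈𝓕 𝓐) × (∃ λ X → X ∈𝓕 𝓑) ×
    Connected 𝓐 × Connected 𝓑 ×
    (∀ X Y → X ∈𝓕 𝓐 → Y ∈𝓕 𝓑 → ¬ Adj X Y)

  Down : Family n → Subset n → Set
  Down 𝓖 X = ∃ λ G → G ∈𝓕 𝓖 × X ⊆ G

  Up : Family n → Subset n → Set
  Up 𝓖 X = ∃ λ G → G ∈𝓕 𝓖 × G ⊆ X

  InFPlus : Family n → Family n → Subset n → Set
  InFPlus 𝓐 𝓑 F = ¬ (Down 𝓐 F ⊎ Down 𝓑 F) ×
    (∀ Y → Y ⊂ F → Down 𝓐 Y ⊎ Down 𝓑 Y)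

  InFMinus : Family n → Family n → Subset n → Set
  InFMinus 𝓐 𝓑 F = ¬ (Up 𝓐 F ⊎ Up 𝓑 F) ×
    (∀ Y → F ⊂ Y → Up 𝓐 Y ⊎ Up 𝓑 Y)

-- Call X below 𝓐 if X ⊆ A for some A ∈ 𝓐, and above 𝓐 if A ⊆ X. No set is above 𝓐 and
-- below 𝓑, for A ⊆ X ⊆ B would be an edge between the components; and by saturation every
-- X ∉ 𝓕 is comparable with some member of 𝓐 (a walk from 𝓐 to 𝓑 through X enters X from 𝓐),
-- and likewise of 𝓑. Let F ∈ 𝓕⁺. Each F - z is below 𝓐 or 𝓑, and F is above both. A member
-- A ⊆ F of 𝓐 contains every z for which F - z is below 𝓑, and F ⊈ A, so some F - x₀ is below
-- 𝓐 only; symmetrically some F - y₀ is below 𝓑 only. Removing from F a point z together with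
-- a partner, x₀ if F - z is below 𝓑 and y₀ otherwise, leaves a set below both, hence above
-- neither; it extends greedily to a maximal such set, a member of 𝓕⁻ of size at least
-- |F| - 2. For z ≠ y₀ these are distinct: a common extension would contain F - x₀ or F - y₀,
-- which are above 𝓐 or 𝓑. Complementation exchanges ⊆ with ⊇ and 𝓕⁺ with 𝓕⁻, giving the
-- second statement.

module Submission where

open import Defs
open import Data.Nat using (ℕ; _≤_; _∸_; _+_; suc; s≤s)
import Data.Nat.Properties as ℕ
open import Data.Bool using (true; _∨_)
import Data.Bool as Bool
open import Data.Bool.Properties using (∨-zeroʳ)
open import Data.Fin using (Fin; zero; suc)
open import Data.Fin.Properties using (suc-injective; _≟_; any?)
open import Data.Fin.Subset using (Subset; ∣_∣; _∈_; _∉_; _⊆_; _⊂_; _-_; _∪_; ⁅_⁆; ∁; inside; outside)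
open import Data.Fin.Subset.Properties
open import Data.Vec using ([]; _∷_; here; there)
open import Data.Vec.Properties using (≡-dec)
open import Data.List using (List; []; _∷_; length; map; foldl; allFin)
open import Data.List.Properties using (length-map)
open import Data.List.Relation.Unary.All as All using (All; []; _∷_)
import Data.List.Relation.Unary.All.Properties as All
open import Data.List.Relation.Unary.AllPairs using ([]; _∷_)
open import Data.List.Relation.Unary.Any using () renaming (here to hereₗ; there to thereₗ)
open import Data.List.Relation.Unary.Unique.Propositional using (Unique)
import Data.List.Relation.Unary.Unique.Propositional.Properties as Unique
import Data.List.Membership.Propositional as List
open import Data.List.Membership.Propositional.Properties using (∈-allFin)
open import Data.Product using (∃; _×_; _,_; proj₁; proj₂; uncurry)
open import Data.Sum using (_⊎_; inj₁; inj₂; [_,_]′)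
import Data.Sum as Sum
open import Data.Empty using (⊥-elim)
open import Function using (id; _∘_)
open import Relation.Nullary using (¬_; yes; no; contradiction)
open import Relation.Nullary.Decidable using (_×-dec_; _⊎-dec_; ¬?; decidable-stable)
open import Relation.Unary using (Pred; Decidable)
open import Relation.Binary.PropositionalEquality
import Algebra.Lattice.Properties.BooleanAlgebra as BooleanAlgebra

private
  variable
    n : ℕ
    𝓕 𝓐 𝓑 𝓖 𝓗 : Family n
    p q : Subset n
    X Y : Subset n
    v x y z : Fin n

∁-involutive : (p : Subset n) → ∁ (∁ p) ≡ p
∁-involutive {n} = BooleanAlgebra.¬-involutive (∪-∩-booleanAlgebra n)

∁-injective : ∁ p ≡ ∁ q → p ≡ q
∁-injective {p = p} {q} eq = begin
  p         ≡⟨ ∁-involutive p ⟨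
  ∁ (∁ p)   ≡⟨ cong ∁ eq ⟩
  ∁ (∁ q)   ≡⟨ ∁-involutive q ⟩
  q         ∎
  where open ≡-Reasoning

p⊆∁q⇒q⊆∁p : p ⊆ ∁ q → q ⊆ ∁ p
p⊆∁q⇒q⊆∁p p⊆∁q x∈q = x∉p⇒x∈∁p (λ x∈p → x∈∁p⇒x∉p (p⊆∁q x∈p) x∈q)

∁p⊆q⇒∁q⊆p : ∁ p ⊆ q → ∁ q ⊆ p
∁p⊆q⇒∁q⊆p ∁p⊆q x∈∁q = x∉∁p⇒x∈p (λ x∈∁p → x∈∁p⇒x∉p x∈∁q (∁p⊆q x∈∁p))

p⊂∁q⇒q⊂∁p : p ⊂ ∁ q → q ⊂ ∁ p
p⊂∁q⇒q⊂∁p (p⊆∁q , x , x∈∁q , x∉p) = p⊆∁q⇒q⊆∁p p⊆∁q , x , x∉p⇒x∈∁p x∉p , x∈∁p⇒x∉p x∈∁q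

∪-lub : {r : Subset n} → p ⊆ r → q ⊆ r → p ∪ q ⊆ r
∪-lub {p = p} {q} p⊆r q⊆r x∈p∪q = [ p⊆r , q⊆r ]′ (x∈p∪q⁻ p q x∈p∪q)

x∈p⇒⁅x⁆⊆p : x ∈ p → ⁅ x ⁆ ⊆ p
x∈p⇒⁅x⁆⊆p {x = x} {p} x∈p y∈⁅x⁆ = subst (_∈ p) (sym (x∈⁅y⁆⇒x≡y x y∈⁅x⁆)) x∈p

x∉p-x : (p : Subset n) (x : Fin n) → x ∉ p - x
x∉p-x (_ ∷ p) zero ()
x∉p-x (_ ∷ p) (suc x) (there x∈p-x) = x∉p-x p x x∈p-x

x∈p-y⇒x≢y : (p : Subset n) → x ∈ p - y → x ≢ y
x∈p-y⇒x≢y {y = y} p x∈p-y refl = x∉p-x p y x∈p-y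

p⊆q∧x∉p⇒p⊆q-x : p ⊆ q → x ∉ p → p ⊆ q - x
p⊆q∧x∉p⇒p⊆q-x p⊆q x∉p y∈p = x∈p∧x≢y⇒x∈p-y (p⊆q y∈p) λ { refl → x∉p y∈p }

p-x⊆p : (p : Subset n) (x : Fin n) → p - x ⊆ p
p-x⊆p p x = p─q⊆p p ⁅ x ⁆

p-x-y⊆p-y : (p : Subset n) (x y : Fin n) → p - x - y ⊆ p - y
p-x-y⊆p-y p x y rewrite p─x─y≡p─y─x p x y = p-x⊆p (p - y) x

∣p∣≤1+∣p-x∣ : (p : Subset n) (x : Fin n) → ∣ p ∣ ≤ suc ∣ p - x ∣
∣p∣≤1+∣p-x∣ (inside ∷ p) zero = ℕ.≤-reflexive (cong (suc ∘ ∣_∣) (sym (p─⊥≡p p)))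
∣p∣≤1+∣p-x∣ (outside ∷ p) zero = ℕ.m≤n⇒m≤1+n (ℕ.≤-reflexive (cong ∣_∣ (sym (p─⊥≡p p))))
∣p∣≤1+∣p-x∣ (inside ∷ p) (suc x) = s≤s (∣p∣≤1+∣p-x∣ p x)
∣p∣≤1+∣p-x∣ (outside ∷ p) (suc x) = ∣p∣≤1+∣p-x∣ p x

elements : Subset n → List (Fin n)
elements [] = []
elements (inside ∷ p) = zero ∷ map suc (elements p)
elements (outside ∷ p) = map suc (elements p)

length-elements : (p : Subset n) → length (elements p) ≡ ∣ p ∣
length-elements [] = refl
length-elements (inside ∷ p) = cong suc (trans (length-map suc (elements p)) (length-elements p))
length-elements (outside ∷ p) = trans (length-map suc (elements p)) (length-elements p)

elements⊆ : (p : Subset n) → All (_∈ p) (elements p)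
elements⊆ [] = []
elements⊆ (inside ∷ p) = here ∷ All.map⁺ (All.map there (elements⊆ p))
elements⊆ (outside ∷ p) = All.map⁺ (All.map there (elements⊆ p))

elements-unique : (p : Subset n) → Unique (elements p)
elements-unique [] = []
elements-unique (inside ∷ p) =
  All.map⁺ (All.universal (λ _ ()) (elements p)) ∷ Unique.map⁺ suc-injective (elements-unique p)
elements-unique (outside ∷ p) = Unique.map⁺ suc-injective (elements-unique p)

map⁺-injectiveOn : ∀ {a b ℓ} {A : Set a} {B : Set b} {P : Pred A ℓ} {f : A → B} →
  (∀ {x y} → P x → P y → f x ≡ f y → x ≡ y) →
  ∀ {xs} → All P xs → Unique xs → Unique (map f xs)
map⁺-injectiveOn inj [] [] = []
map⁺-injectiveOn inj (px ∷ pxs) (x∉xs ∷ xs!) =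
  All.map⁺ (All.zipWith (λ (py , x≢y) fx≡fy → x≢y (inj px py fx≡fy)) (pxs , x∉xs))
  ∷ map⁺-injectiveOn inj pxs xs!

m∸n≤o⇒m∸o≤n : ∀ m n o → m ∸ n ≤ o → m ∸ o ≤ n
m∸n≤o⇒m∸o≤n m n o m∸n≤o = ℕ.m≤n+o⇒m∸n≤o m o (begin
  m            ≤⟨ ℕ.m≤n+m∸n m n ⟩
  n + (m ∸ n)  ≤⟨ ℕ.+-monoʳ-≤ n m∸n≤o ⟩
  n + o        ≡⟨ ℕ.+-comm n o ⟩
  o + n        ∎)
  where open ℕ.≤-Reasoning

module MaximalExtension {ℓ} {U : Pred (Subset n) ℓ} (U? : Decidable U)
                        (U-mono : ∀ {X Y} → X ⊆ Y → U X → U Y) where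

  grow : Subset n → Fin n → Subset n
  grow S i with U? (S ∪ ⁅ i ⁆)
  ... | yes _ = S
  ... | no _ = S ∪ ⁅ i ⁆

  extend : Subset n → Subset n
  extend S = foldl grow S (allFin n)

  ⊆-grow : ∀ S i → S ⊆ grow S i
  ⊆-grow S i with U? (S ∪ ⁅ i ⁆)
  ... | yes _ = id
  ... | no _ = p⊆p∪q ⁅ i ⁆

  grow-¬U : ∀ S i → ¬ U S → ¬ U (grow S i)
  grow-¬U S i ¬US with U? (S ∪ ⁅ i ⁆)
  ... | yes _ = ¬US
  ... | no ¬US∪i = ¬US∪i

  ∈-grow⊎U : ∀ S i → i ∈ grow S i ⊎ U (S ∪ ⁅ i ⁆)
  ∈-grow⊎U S i with U? (S ∪ ⁅ i ⁆)
  ... | yes US∪i = inj₂ US∪i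
  ... | no _ = inj₁ (q⊆p∪q S ⁅ i ⁆ (x∈⁅x⁆ i))

  ⊆-foldl : ∀ S is → S ⊆ foldl grow S is
  ⊆-foldl S [] = id
  ⊆-foldl S (i ∷ is) = ⊆-foldl (grow S i) is ∘ ⊆-grow S i

  foldl-¬U : ∀ S is → ¬ U S → ¬ U (foldl grow S is)
  foldl-¬U S [] ¬US = ¬US
  foldl-¬U S (i ∷ is) ¬US = foldl-¬U (grow S i) is (grow-¬U S i ¬US)

  ∈-foldl⊎U : ∀ S {i is} → i List.∈ is → i ∈ foldl grow S is ⊎ U (foldl grow S is ∪ ⁅ i ⁆)
  ∈-foldl⊎U S {i} {_ ∷ is} (hereₗ refl) =
    Sum.map (⊆-foldl (grow S i) is) (U-mono (∪-lub (p⊆p∪q ⁅ i ⁆ ∘ S⊆) (q⊆p∪q _ ⁅ i ⁆))) (∈-grow⊎U S i)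
    where
    S⊆ : S ⊆ foldl grow (grow S i) is
    S⊆ = ⊆-foldl (grow S i) is ∘ ⊆-grow S i
  ∈-foldl⊎U S {is = j ∷ is} (thereₗ i∈is) = ∈-foldl⊎U (grow S j) i∈is

  ⊆-extend : ∀ S → S ⊆ extend S
  ⊆-extend S = ⊆-foldl S (allFin n)

  extend-¬U : ∀ {S} → ¬ U S → ¬ U (extend S)
  extend-¬U {S} = foldl-¬U S (allFin n)

  extend-maximal : ∀ S Y → extend S ⊂ Y → U Y
  extend-maximal S Y (E⊆Y , i , i∈Y , i∉E) with ∈-foldl⊎U S (∈-allFin i)
  ... | inj₁ i∈E = contradiction i∈E i∉E
  ... | inj₂ UE∪i = U-mono (∪-lub E⊆Y (x∈p⇒⁅x⁆⊆p i∈Y)) UE∪i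

∈insert⁻ : (𝓖 : Family n) (X Y : Subset n) → Y ∈𝓕 insert X 𝓖 → Y ∈𝓕 𝓖 ⊎ Y ≡ X
∈insert⁻ 𝓖 X Y Y∈ with 𝓖 Y | ≡-dec Bool._≟_ Y X
... | true | _ = inj₁ refl
... | _ | yes Y≡X = inj₂ Y≡X

∈insert⁺ : (𝓖 : Family n) (X Y : Subset n) → Y ∈𝓕 𝓖 ⊎ Y ≡ X → Y ∈𝓕 insert X 𝓖
∈insert⁺ 𝓖 X Y (inj₁ Y∈𝓖) = cong (_∨ _) Y∈𝓖
∈insert⁺ 𝓖 X Y (inj₂ refl) with ≡-dec Bool._≟_ Y Y
... | yes _ = ∨-zeroʳ (𝓖 Y)
... | no Y≢Y = contradiction refl Y≢Y

Adj-sym : Adj X Y → Adj Y X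
Adj-sym (X≢Y , X⊆Y⊎Y⊆X) = ≢-sym X≢Y , Sum.swap X⊆Y⊎Y⊆X

Adj-∁ : Adj X Y → Adj (∁ X) (∁ Y)
Adj-∁ (X≢Y , X⊆Y⊎Y⊆X) = X≢Y ∘ ∁-injective , Sum.swap (Sum.map p⊆q⇒∁p⊇∁q p⊆q⇒∁p⊇∁q X⊆Y⊎Y⊆X)

source∈ : Walk 𝓖 X Y → X ∈𝓕 𝓖
source∈ (here X∈𝓖) = X∈𝓖
source∈ (step X∈𝓖 _ _) = X∈𝓖

Walk-map : (f : Subset n → Subset n) → (∀ {X Y} → Adj X Y → Adj (f X) (f Y)) →
  (∀ {X} → X ∈𝓕 𝓖 → f X ∈𝓕 𝓗) → Walk 𝓖 X Y → Walk 𝓗 (f X) (f Y)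
Walk-map f f-adj f-∈ (here X∈𝓖) = here (f-∈ X∈𝓖)
Walk-map f f-adj f-∈ (step X∈𝓖 X~Y w) = step (f-∈ X∈𝓖) (f-adj X~Y) (Walk-map f f-adj f-∈ w)

Connected-∁ : (∀ {X} → X ∈𝓕 𝓗 → ∁ X ∈𝓕 𝓖) → (∀ {X} → X ∈𝓕 𝓖 → ∁ X ∈𝓕 𝓗) →
  Connected 𝓖 → Connected 𝓗
Connected-∁ {𝓗 = 𝓗} to from conn X Y X∈𝓗 Y∈𝓗 =
  subst₂ (Walk 𝓗) (∁-involutive X) (∁-involutive Y)
    (Walk-map ∁ Adj-∁ from (conn (∁ X) (∁ Y) (to X∈𝓗) (to Y∈𝓗)))

Up-mono : X ⊆ Y → Up 𝓖 X → Up 𝓖 Y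
Up-mono X⊆Y (G , G∈𝓖 , G⊆X) = G , G∈𝓖 , X⊆Y ∘ G⊆X

Up-refl : X ∈𝓕 𝓖 → Up 𝓖 X
Up-refl X∈𝓖 = _ , X∈𝓖 , ⊆-refl

Down-refl : X ∈𝓕 𝓖 → Down 𝓖 X
Down-refl X∈𝓖 = _ , X∈𝓖 , ⊆-refl

Down-mono : Y ⊆ X → Down 𝓖 X → Down 𝓖 Y
Down-mono Y⊆X (G , G∈𝓖 , X⊆G) = G , G∈𝓖 , X⊆G ∘ Y⊆X

Up? : (𝓖 : Family n) → Decidable (Up 𝓖)
Up? 𝓖 X = anySubset? (λ G → (𝓖 G Bool.≟ true) ×-dec (G ⊆? X))

Down? : (𝓖 : Family n) → Decidable (Down 𝓖)
Down? 𝓖 X = anySubset? (λ G → (𝓖 G Bool.≟ true) ×-dec (X ⊆? G))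

Up⊎ : Family n → Family n → Pred (Subset n) _
Up⊎ 𝓐 𝓑 X = Up 𝓐 X ⊎ Up 𝓑 X

Up⊎-mono : X ⊆ Y → Up⊎ 𝓐 𝓑 X → Up⊎ 𝓐 𝓑 Y
Up⊎-mono X⊆Y = Sum.map (Up-mono X⊆Y) (Up-mono X⊆Y)

Up⊎? : (𝓐 𝓑 : Family n) → Decidable (Up⊎ 𝓐 𝓑)
Up⊎? 𝓐 𝓑 X = Up? 𝓐 X ⊎-dec Up? 𝓑 X

InFPlus-swap : InFPlus 𝓐 𝓑 X → InFPlus 𝓑 𝓐 X
InFPlus-swap (¬Down , Down-below) = ¬Down ∘ Sum.swap , λ Y Y⊂X → Sum.swap (Down-below Y Y⊂X)

record SaturatedSplit (𝓕 𝓐 𝓑 : Family n) : Set where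
  field
    saturated  : ∀ X → ¬ X ∈𝓕 𝓕 → Connected (insert X 𝓕)
    split      : X ∈𝓕 𝓕 → X ∈𝓕 𝓐 ⊎ X ∈𝓕 𝓑
    𝓐⊆𝓕        : X ∈𝓕 𝓐 → X ∈𝓕 𝓕
    𝓑⊆𝓕        : X ∈𝓕 𝓑 → X ∈𝓕 𝓕
    disjoint   : X ∈𝓕 𝓐 → ¬ X ∈𝓕 𝓑
    𝓐-nonempty : ∃ λ A → A ∈𝓕 𝓐
    𝓑-nonempty : ∃ λ B → B ∈𝓕 𝓑
    no-edge    : X ∈𝓕 𝓐 → Y ∈𝓕 𝓑 → ¬ Adj X Y

swapSides : SaturatedSplit 𝓕 𝓐 𝓑 → SaturatedSplit 𝓕 𝓑 𝓐
swapSides S = record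
  { saturated  = saturated
  ; split      = Sum.swap ∘ split
  ; 𝓐⊆𝓕        = 𝓑⊆𝓕
  ; 𝓑⊆𝓕        = 𝓐⊆𝓕
  ; disjoint   = λ X∈𝓑 X∈𝓐 → disjoint X∈𝓐 X∈𝓑
  ; 𝓐-nonempty = 𝓑-nonempty
  ; 𝓑-nonempty = 𝓐-nonempty
  ; no-edge    = λ X∈𝓑 Y∈𝓐 X~Y → no-edge Y∈𝓐 X∈𝓑 (Adj-sym X~Y)
  }
  where open SaturatedSplit S

module _ (S : SaturatedSplit 𝓕 𝓐 𝓑) where
  open SaturatedSplit S

  walk-enters-from-𝓐 : ∀ {A B} → A ∈𝓕 𝓐 → B ∈𝓕 𝓑 → Walk (insert X 𝓕) A B →
    ∃ λ A′ → A′ ∈𝓕 𝓐 × Adj A′ X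
  walk-enters-from-𝓐 A∈𝓐 B∈𝓑 (here _) = ⊥-elim (disjoint A∈𝓐 B∈𝓑)
  walk-enters-from-𝓐 {X} {A} A∈𝓐 B∈𝓑 (step {Y = Y} _ A~Y w)
    with ∈insert⁻ 𝓕 X Y (source∈ w)
  ... | inj₂ refl = A , A∈𝓐 , A~Y
  ... | inj₁ Y∈𝓕 with split Y∈𝓕
  ...   | inj₁ Y∈𝓐 = walk-enters-from-𝓐 Y∈𝓐 B∈𝓑 w
  ...   | inj₂ Y∈𝓑 = ⊥-elim (no-edge A∈𝓐 Y∈𝓑 A~Y)

  Down⊎Up : ¬ X ∈𝓕 𝓕 → Down 𝓐 X ⊎ Up 𝓐 X
  Down⊎Up {X} X∉𝓕 with 𝓐-nonempty | 𝓑-nonempty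
  ... | A , A∈𝓐 | B , B∈𝓑
    with walk-enters-from-𝓐 A∈𝓐 B∈𝓑
           (saturated X X∉𝓕 A B (∈insert⁺ 𝓕 X A (inj₁ (𝓐⊆𝓕 A∈𝓐))) (∈insert⁺ 𝓕 X B (inj₁ (𝓑⊆𝓕 B∈𝓑))))
  ...   | A′ , A′∈𝓐 , _ , inj₁ A′⊆X = inj₂ (A′ , A′∈𝓐 , A′⊆X)
  ...   | A′ , A′∈𝓐 , _ , inj₂ X⊆A′ = inj₁ (A′ , A′∈𝓐 , X⊆A′)

  ∈𝓕⇒Down⊎ : X ∈𝓕 𝓕 → Down 𝓐 X ⊎ Down 𝓑 X
  ∈𝓕⇒Down⊎ X∈𝓕 = Sum.map Down-refl Down-refl (split X∈𝓕)

  Up⇒¬Down : Up 𝓐 X → ¬ Down 𝓑 X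
  Up⇒¬Down (A , A∈𝓐 , A⊆X) (B , B∈𝓑 , X⊆B) = no-edge A∈𝓐 B∈𝓑 (A≢B , inj₁ (X⊆B ∘ A⊆X))
    where
    A≢B : A ≢ B
    A≢B refl = disjoint A∈𝓐 B∈𝓑

module _ (S : SaturatedSplit 𝓕 𝓐 𝓑) where
  open SaturatedSplit S

  ¬Down⇒Up⊎ : ¬ Down 𝓑 X → Up⊎ 𝓐 𝓑 X
  ¬Down⇒Up⊎ {X} ¬Down𝓑 with 𝓕 X Bool.≟ true
  ... | yes X∈𝓕 = [ inj₁ ∘ Up-refl , ⊥-elim ∘ ¬Down𝓑 ∘ Down-refl ]′ (split X∈𝓕)
  ... | no X∉𝓕 = inj₂ ([ ⊥-elim ∘ ¬Down𝓑 , id ]′ (Down⊎Up (swapSides S) X∉𝓕))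

  Down×Down⇒¬Up⊎ : Down 𝓐 X → Down 𝓑 X → ¬ Up⊎ 𝓐 𝓑 X
  Down×Down⇒¬Up⊎ Down𝓐 Down𝓑 =
    [ (λ Up𝓐 → Up⇒¬Down S Up𝓐 Down𝓑) , (λ Up𝓑 → Up⇒¬Down (swapSides S) Up𝓑 Down𝓐) ]′

module _ (S : SaturatedSplit 𝓕 𝓐 𝓑) {F : Subset n} (F⁺ : InFPlus 𝓐 𝓑 F) where

  InFPlus⇒Up : Up 𝓐 F
  InFPlus⇒Up with Down⊎Up S (proj₁ F⁺ ∘ ∈𝓕⇒Down⊎ S)
  ... | inj₁ Down𝓐 = contradiction (inj₁ Down𝓐) (proj₁ F⁺)
  ... | inj₂ Up𝓐 = Up𝓐

  Down-deletion-𝓐 : x ∈ F → ¬ Down 𝓑 (F - x) → Down 𝓐 (F - x)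
  Down-deletion-𝓐 x∈F ¬Down𝓑 =
    [ id , ⊥-elim ∘ ¬Down𝓑 ]′ (proj₂ F⁺ (F - _) (x∈p⇒p-x⊂p x∈F))

  ∃-𝓐-only-deletion : ∃ λ x → Down 𝓐 (F - x) × ¬ Down 𝓑 (F - x)
  ∃-𝓐-only-deletion with any? (λ x → Down? 𝓐 (F - x) ×-dec ¬? (Down? 𝓑 (F - x)))
  ... | yes 𝓐-only = 𝓐-only
  ... | no ∄𝓐-only with InFPlus⇒Up
  ...   | A , A∈𝓐 , A⊆F = ⊥-elim (proj₁ F⁺ (inj₁ (A , A∈𝓐 , F⊆A)))
    where
    F⊆A : F ⊆ A
    F⊆A {z} z∈F = decidable-stable (z ∈? A) λ z∉A →
      let ¬Down𝓑 = Up⇒¬Down S (A , A∈𝓐 , p⊆q∧x∉p⇒p⊆q-x A⊆F z∉A)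
      in ∄𝓐-only (z , Down-deletion-𝓐 z∈F ¬Down𝓑 , ¬Down𝓑)

module Deletions (S : SaturatedSplit 𝓕 𝓐 𝓑) {F : Subset n} (F⁺ : InFPlus 𝓐 𝓑 F) {x₀ y₀ : Fin n}
                 (x₀-𝓐-only : Down 𝓐 (F - x₀) × ¬ Down 𝓑 (F - x₀))
                 (y₀-𝓑-only : Down 𝓑 (F - y₀) × ¬ Down 𝓐 (F - y₀)) where

  open MaximalExtension (Up⊎? 𝓐 𝓑) Up⊎-mono

  partner : Fin n → Fin n
  partner z with Down? 𝓑 (F - z)
  ... | yes _ = x₀
  ... | no _ = y₀

  partner≡x₀⊎y₀ : ∀ z → partner z ≡ x₀ ⊎ partner z ≡ y₀
  partner≡x₀⊎y₀ z with Down? 𝓑 (F - z)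
  ... | yes _ = inj₁ refl
  ... | no _ = inj₂ refl

  Up⊎-F-partner : ∀ z → Up⊎ 𝓐 𝓑 (F - partner z)
  Up⊎-F-partner z with Down? 𝓑 (F - z)
  ... | yes _ = ¬Down⇒Up⊎ S (proj₂ x₀-𝓐-only)
  ... | no _ = Sum.swap (¬Down⇒Up⊎ (swapSides S) (proj₂ y₀-𝓑-only))

  pruned : Fin n → Subset n
  pruned z = F - z - partner z

  pruned-below-both : z ∈ F → Down 𝓐 (pruned z) × Down 𝓑 (pruned z)
  pruned-below-both {z} z∈F with Down? 𝓑 (F - z)
  ... | yes Down𝓑 =
    Down-mono (p-x-y⊆p-y F z x₀) (proj₁ x₀-𝓐-only) , Down-mono (p-x⊆p (F - z) x₀) Down𝓑
  ... | no ¬Down𝓑 =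
    Down-mono (p-x⊆p (F - z) y₀) (Down-deletion-𝓐 S F⁺ z∈F ¬Down𝓑) ,
    Down-mono (p-x-y⊆p-y F z y₀) (proj₁ y₀-𝓑-only)

  maximalAbove : Fin n → Subset n
  maximalAbove z = extend (pruned z)

  maximalAbove-InFMinus : z ∈ F → InFMinus 𝓐 𝓑 (maximalAbove z)
  maximalAbove-InFMinus {z} z∈F =
    extend-¬U (uncurry (Down×Down⇒¬Up⊎ S) (pruned-below-both z∈F)) , extend-maximal (pruned z)

  ∣F∣∸2≤∣maximalAbove∣ : ∀ z → ∣ F ∣ ∸ 2 ≤ ∣ maximalAbove z ∣
  ∣F∣∸2≤∣maximalAbove∣ z = ℕ.m≤n+o⇒m∸n≤o ∣ F ∣ 2 (begin
    ∣ F ∣                   ≤⟨ ∣p∣≤1+∣p-x∣ F z ⟩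
    suc ∣ F - z ∣           ≤⟨ s≤s (∣p∣≤1+∣p-x∣ (F - z) (partner z)) ⟩
    2 + ∣ pruned z ∣        ≤⟨ ℕ.+-monoʳ-≤ 2 (p⊆q⇒∣p∣≤∣q∣ (⊆-extend (pruned z))) ⟩
    2 + ∣ maximalAbove z ∣  ∎)
    where open ℕ.≤-Reasoning

  ∈-pruned : v ∈ F → v ≢ z → v ≢ partner z → v ∈ pruned z
  ∈-pruned v∈F v≢z v≢partner = x∈p∧x≢y⇒x∈p-y (x∈p∧x≢y⇒x∈p-y v∈F v≢z) v≢partner

  -- Partners lie in {x₀, y₀}, so if z′ is neither, the only point of F that can be
  -- missing from both pruned z and pruned z′ is partner z′.
  F-partner⊆ : ∀ {z z′ M} → z ≢ z′ → z′ ≢ x₀ → z′ ≢ y₀ →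
    pruned z ⊆ M → pruned z′ ⊆ M → F - partner z′ ⊆ M
  F-partner⊆ {z} {z′} z≢z′ z′≢x₀ z′≢y₀ pruned-z⊆M pruned-z′⊆M {v} v∈ with v ≟ z′
  ... | yes refl = pruned-z⊆M (∈-pruned (p-x⊆p F (partner v) v∈) (≢-sym z≢z′) v≢partner)
    where
    v≢partner : v ≢ partner z
    v≢partner v≡partner = [ z′≢x₀ ∘ trans v≡partner , z′≢y₀ ∘ trans v≡partner ]′ (partner≡x₀⊎y₀ z)
  ... | no v≢z′ = pruned-z′⊆M (∈-pruned (p-x⊆p F (partner z′) v∈) v≢z′ (x∈p-y⇒x≢y F v∈))

  maximalAbove-collision : ∀ {z z′} → z ∈ F → z ≢ z′ → z′ ≢ x₀ → z′ ≢ y₀ →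
    maximalAbove z ≢ maximalAbove z′
  maximalAbove-collision {z} {z′} z∈F z≢z′ z′≢x₀ z′≢y₀ same =
    proj₁ (maximalAbove-InFMinus z∈F) (Up⊎-mono F-partner⊆M (Up⊎-F-partner z′))
    where
    F-partner⊆M : F - partner z′ ⊆ maximalAbove z
    F-partner⊆M = F-partner⊆ z≢z′ z′≢x₀ z′≢y₀ (⊆-extend (pruned z))
      (subst (pruned z′ ⊆_) (sym same) (⊆-extend (pruned z′)))

  maximalAbove-injectiveOn : ∀ {z z′} → z ∈ F - y₀ → z′ ∈ F - y₀ →
    maximalAbove z ≡ maximalAbove z′ → z ≡ z′
  maximalAbove-injectiveOn {z} {z′} z∈ z′∈ same with z ≟ z′ | z′ ≟ x₀
  ... | yes z≡z′ | _ = z≡z′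
  ... | no z≢z′ | no z′≢x₀ =
    contradiction same (maximalAbove-collision (p-x⊆p F y₀ z∈) z≢z′ z′≢x₀ (x∈p-y⇒x≢y F z′∈))
  ... | no z≢z′ | yes refl =
    contradiction (sym same)
      (maximalAbove-collision (p-x⊆p F y₀ z′∈) (≢-sym z≢z′) z≢z′ (x∈p-y⇒x≢y F z∈))

  family : ∃ λ (L : List (Subset n)) → Unique L × ∣ F ∣ ∸ 1 ≤ length L ×
    All (λ Y → InFMinus 𝓐 𝓑 Y × ∣ F ∣ ∸ 2 ≤ ∣ Y ∣) L
  family = map maximalAbove zs
         , map⁺-injectiveOn maximalAbove-injectiveOn (elements⊆ (F - y₀)) (elements-unique (F - y₀))
         , ∣F∣∸1≤length
         , All.map⁺ (All.map (λ {z} z∈ → maximalAbove-InFMinus (p-x⊆p F y₀ z∈) , ∣F∣∸2≤∣maximalAbove∣ z)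
                             (elements⊆ (F - y₀)))
    where
    zs : List (Fin n)
    zs = elements (F - y₀)
    ∣F∣∸1≤length : ∣ F ∣ ∸ 1 ≤ length (map maximalAbove zs)
    ∣F∣∸1≤length = begin
      ∣ F ∣ ∸ 1                     ≤⟨ ℕ.m≤n+o⇒m∸n≤o ∣ F ∣ 1 (∣p∣≤1+∣p-x∣ F y₀) ⟩
      ∣ F - y₀ ∣                    ≡⟨ length-elements (F - y₀) ⟨
      length zs                     ≡⟨ length-map maximalAbove zs ⟨
      length (map maximalAbove zs)  ∎
      where open ℕ.≤-Reasoning

InFPlus⇒InFMinus-family : SaturatedSplit 𝓕 𝓐 𝓑 → ∀ {F} → InFPlus 𝓐 𝓑 F →
  ∃ λ (L : List (Subset n)) → Unique L × ∣ F ∣ ∸ 1 ≤ length L ×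
    All (λ Y → InFMinus 𝓐 𝓑 Y × ∣ F ∣ ∸ 2 ≤ ∣ Y ∣) L
InFPlus⇒InFMinus-family S F⁺ = Deletions.family S F⁺
  (proj₂ (∃-𝓐-only-deletion S F⁺)) (proj₂ (∃-𝓐-only-deletion (swapSides S) (InFPlus-swap F⁺)))

dual : Family n → Family n
dual 𝓖 X = 𝓖 (∁ X)

∈dual⁺ : (𝓖 : Family n) (X : Subset n) → X ∈𝓕 𝓖 → ∁ X ∈𝓕 dual 𝓖
∈dual⁺ 𝓖 X X∈𝓖 = trans (cong 𝓖 (∁-involutive X)) X∈𝓖

Up-dual⁺ : Down 𝓖 (∁ X) → Up (dual 𝓖) X
Up-dual⁺ {𝓖 = 𝓖} (H , H∈𝓖 , ∁X⊆H) = ∁ H , ∈dual⁺ 𝓖 H H∈𝓖 , ∁p⊆q⇒∁q⊆p ∁X⊆H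

Up-dual⁻ : Up (dual 𝓖) X → Down 𝓖 (∁ X)
Up-dual⁻ (G , ∁G∈𝓖 , G⊆X) = ∁ G , ∁G∈𝓖 , p⊆q⇒∁p⊇∁q G⊆X

Down-dual⁺ : Up 𝓖 (∁ X) → Down (dual 𝓖) X
Down-dual⁺ {𝓖 = 𝓖} (H , H∈𝓖 , H⊆∁X) = ∁ H , ∈dual⁺ 𝓖 H H∈𝓖 , p⊆∁q⇒q⊆∁p H⊆∁X

Down-dual⁻ : Down (dual 𝓖) X → Up 𝓖 (∁ X)
Down-dual⁻ (G , ∁G∈𝓖 , X⊆G) = ∁ G , ∁G∈𝓖 , p⊆q⇒∁p⊇∁q X⊆G

InFMinus⇒InFPlus-dual : InFMinus 𝓐 𝓑 X → InFPlus (dual 𝓐) (dual 𝓑) (∁ X)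
InFMinus⇒InFPlus-dual {𝓐 = 𝓐} {𝓑} {X} (¬Up⊎ , Up⊎-above) =
  ¬Up⊎ ∘ subst (Up⊎ 𝓐 𝓑) (∁-involutive X) ∘ Sum.map Down-dual⁻ Down-dual⁻ ,
  λ Y Y⊂∁X → Sum.map Down-dual⁺ Down-dual⁺ (Up⊎-above (∁ Y) (p⊂∁q⇒q⊂∁p Y⊂∁X))

InFMinus-dual⇒InFPlus : InFMinus (dual 𝓐) (dual 𝓑) X → InFPlus 𝓐 𝓑 (∁ X)
InFMinus-dual⇒InFPlus {𝓐 = 𝓐} {𝓑} (¬Up⊎ , Up⊎-above) =
  ¬Up⊎ ∘ Sum.map Up-dual⁺ Up-dual⁺ ,
  λ Y Y⊂∁X → subst (λ Z → Down 𝓐 Z ⊎ Down 𝓑 Z) (∁-involutive Y)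
                   (Sum.map Up-dual⁻ Up-dual⁻ (Up⊎-above (∁ Y) (p⊂∁q⇒q⊂∁p Y⊂∁X)))

dualSplit : SaturatedSplit 𝓕 𝓐 𝓑 → SaturatedSplit (dual 𝓕) (dual 𝓐) (dual 𝓑)
dualSplit {𝓕 = 𝓕} {𝓐} {𝓑} S = record
  { saturated  = λ X ∁X∉𝓕 → Connected-∁ {𝓗 = insert X (dual 𝓕)} {insert (∁ X) 𝓕}
                               (to X) (from X) (saturated (∁ X) ∁X∉𝓕)
  ; split      = split
  ; 𝓐⊆𝓕        = 𝓐⊆𝓕
  ; 𝓑⊆𝓕        = 𝓑⊆𝓕
  ; disjoint   = disjoint
  ; 𝓐-nonempty = ∁ (proj₁ 𝓐-nonempty) , ∈dual⁺ 𝓐 _ (proj₂ 𝓐-nonempty)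
  ; 𝓑-nonempty = ∁ (proj₁ 𝓑-nonempty) , ∈dual⁺ 𝓑 _ (proj₂ 𝓑-nonempty)
  ; no-edge    = λ X∈𝓐 Y∈𝓑 X~Y → no-edge X∈𝓐 Y∈𝓑 (Adj-∁ X~Y)
  }
  where
  open SaturatedSplit S
  to : ∀ X {Y} → Y ∈𝓕 insert X (dual 𝓕) → ∁ Y ∈𝓕 insert (∁ X) 𝓕
  to X {Y} Y∈ = ∈insert⁺ 𝓕 (∁ X) (∁ Y) (Sum.map id (cong ∁) (∈insert⁻ (dual 𝓕) X Y Y∈))
  from : ∀ X {Y} → Y ∈𝓕 insert (∁ X) 𝓕 → ∁ Y ∈𝓕 insert X (dual 𝓕)
  from X {Y} Y∈ = ∈insert⁺ (dual 𝓕) X (∁ Y)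
    (Sum.map (∈dual⁺ 𝓕 Y) (λ Y≡∁X → trans (cong ∁ Y≡∁X) (∁-involutive X)) (∈insert⁻ 𝓕 (∁ X) Y Y∈))

InFMinus⇒InFPlus-family : SaturatedSplit 𝓕 𝓐 𝓑 → ∀ {F} → InFMinus 𝓐 𝓑 F →
  ∃ λ (L : List (Subset n)) → Unique L × n ∸ ∣ F ∣ ∸ 1 ≤ length L ×
    All (λ Y → InFPlus 𝓐 𝓑 Y × ∣ Y ∣ ≤ ∣ F ∣ + 2) L
InFMinus⇒InFPlus-family {n = n} {𝓐 = 𝓐} {𝓑} S {F} F⁻ =
  let L , L! , ∣∁F∣∸1≤length , large =
        InFPlus⇒InFMinus-family (dualSplit S) (InFMinus⇒InFPlus-dual F⁻)
  in map ∁ L , Unique.map⁺ ∁-injective L! ,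
     subst₂ _≤_ (cong (_∸ 1) (∣∁p∣≡n∸∣p∣ F)) (sym (length-map ∁ L)) ∣∁F∣∸1≤length ,
     All.map⁺ (All.map (λ {Y} → dualise {Y}) large)
  where
  ∣∁Y∣≤ : ∀ Y → ∣ ∁ F ∣ ∸ 2 ≤ ∣ Y ∣ → ∣ ∁ Y ∣ ≤ ∣ F ∣ + 2
  ∣∁Y∣≤ Y ∣∁F∣∸2≤∣Y∣ = begin
    ∣ ∁ Y ∣      ≡⟨ ∣∁p∣≡n∸∣p∣ Y ⟩
    n ∸ ∣ Y ∣    ≤⟨ m∸n≤o⇒m∸o≤n n (∣ F ∣ + 2) ∣ Y ∣ n∸[∣F∣+2]≤∣Y∣ ⟩
    ∣ F ∣ + 2    ∎
    where
    open ℕ.≤-Reasoning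
    n∸[∣F∣+2]≤∣Y∣ : n ∸ (∣ F ∣ + 2) ≤ ∣ Y ∣
    n∸[∣F∣+2]≤∣Y∣ = begin
      n ∸ (∣ F ∣ + 2)  ≡⟨ ℕ.∸-+-assoc n ∣ F ∣ 2 ⟨
      n ∸ ∣ F ∣ ∸ 2    ≡⟨ cong (_∸ 2) (∣∁p∣≡n∸∣p∣ F) ⟨
      ∣ ∁ F ∣ ∸ 2      ≤⟨ ∣∁F∣∸2≤∣Y∣ ⟩
      ∣ Y ∣            ∎

  dualise : ∀ {Y} → InFMinus (dual 𝓐) (dual 𝓑) Y × ∣ ∁ F ∣ ∸ 2 ≤ ∣ Y ∣ →
    InFPlus 𝓐 𝓑 (∁ Y) × ∣ ∁ Y ∣ ≤ ∣ F ∣ + 2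
  dualise {Y} (Y⁻ , ∣∁F∣∸2≤∣Y∣) = InFMinus-dual⇒InFPlus {X = Y} Y⁻ , ∣∁Y∣≤ Y ∣∁F∣∸2≤∣Y∣

lemma4p5 : (n : ℕ) (𝓕 𝓐 𝓑 : Family n) →
    ¬ Connected 𝓕 →
    (∀ X → ¬ (X ∈𝓕 𝓕) → Connected (insert X 𝓕)) →
    TwoComponents 𝓕 𝓐 𝓑 →
    (∀ F → InFPlus 𝓐 𝓑 F →
      ∃ λ (L : List (Subset n)) → Unique L × ∣ F ∣ ∸ 1 ≤ length L ×
        All (λ Y → InFMinus 𝓐 𝓑 Y × ∣ F ∣ ∸ 2 ≤ ∣ Y ∣) L) ×
    (∀ F → InFMinus 𝓐 𝓑 F →
      ∃ λ (L : List (Subset n)) → Unique L × n ∸ ∣ F ∣ ∸ 1 ≤ length L ×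
        All (λ Y → InFPlus 𝓐 𝓑 Y × ∣ Y ∣ ≤ ∣ F ∣ + 2) L)
lemma4p5 n 𝓕 𝓐 𝓑 _ saturated (split , merge , disjoint , 𝓐-nonempty , 𝓑-nonempty , _ , _ , no-edge) =
  (λ F → InFPlus⇒InFMinus-family S {F}) , (λ F → InFMinus⇒InFPlus-family S {F})
  where
  S : SaturatedSplit 𝓕 𝓐 𝓑
  S = record
    { saturated  = saturated
    ; split      = λ {X} → split X
    ; 𝓐⊆𝓕        = λ {X} X∈𝓐 → merge X (inj₁ X∈𝓐)
    ; 𝓑⊆𝓕        = λ {X} X∈𝓑 → merge X (inj₂ X∈𝓑)
    ; disjoint   = λ {X} → disjoint X
    ; 𝓐-nonempty = 𝓐-nonempty
    ; 𝓑-nonempty = 𝓑-nonempty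
    ; no-edge    = λ {X} {Y} → no-edge X Y
    }
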